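{- For every sequent $S$: if $S$ is provable in $\mathsf{G}^{\mathrm{fin}}+\mathrm{Cut}$, then $S$ is provable in $\mathsf{G}^{\infty}+\mathrm{Cut}$.
   Context: Formulas: $\phi ::= p \mid \bot \mid \phi\to\phi \mid \phi\rhd\phi$. A sequent $\Gamma\Rightarrow\Delta$ is a pair of finite multisets of formulas; commas denote multiset union; $\Sigma\rhd\bot := \{\sigma\rhd\bot:\sigma\in\Sigma\}$; for formulas $\phi_0,\dots,\phi_{m-1}$, $\Phi_{[0,i)} := \{\phi_0,\dots,\phi_{i-1}\}$. Rules: (ax) $p,\Gamma\Rightarrow p,\Delta$ for a variable $p$; ($\bot$L) $\bot,\Gamma\Rightarrow\Delta$; ($\bot$R) from $\Gamma\Rightarrow\Delta$ infer $\Gamma\Rightarrow\bot,\Delta$; ($\to$L) from $\Gamma\Rightarrow\Delta,\phi$ and $\psi,\Gamma\Rightarrow\Delta$ infer $\phi\to\psi,\Gamma\Rightarrow\Delta$; ($\to$R) from $\phi,\Gamma\Rightarrow\Delta,\psi$ infer $\Gamma\Rightarrow\Delta,\phi\to\psi$; ($\rhd_{\mathsf{IL}}$) for $m\ge0$: from the premises $\psi_i,(\psi_i,\Phi_{[0,i)},\phi)\rhd\bot\Rightarrow\Phi_{[0,i)},\phi$ ($i=0,\dots,m$) infer $\phi_0\rhd\psi_0,\dots,\phi_{m-1}\rhd\psi_{m-1},\Gamma\Rightarrow\psi_m\rhd\phi,\Delta$; ($\rhd_{\mathsf{IK4}}$) the same conclusion from the premises $\psi_i,(\Phi_{[0,i)},\phi)\rhd\bot\Rightarrow\Phi_{[0,i)},\phi$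 ($i=0,\dots,m$); (Cut) from $\Gamma\Rightarrow\Delta,\chi$ and $\chi,\Gamma\Rightarrow\Delta$ infer $\Gamma\Rightarrow\Delta$. $\mathsf{G}^{\mathrm{fin}}+\mathrm{Cut}$: finite proof trees using ax, $\bot$L, $\bot$R, $\to$L, $\to$R, $\rhd_{\mathsf{IL}}$, Cut. $\mathsf{G}^{\infty}+\mathrm{Cut}$: a proof is a possibly infinite, finitely branching tree whose nodes are labelled with sequents and with rules among ax, $\bot$L, $\bot$R, $\to$L, $\to$R, $\rhd_{\mathsf{IK4}}$, Cut, such that each node together with its children is an instance of the rule labelling the node (so all leaves are ax or $\bot$L), and every infinite branch passes infinitely often from the conclusion of a $\rhd_{\mathsf{IK4}}$ instance to one of its premises. $\mathsf{G}^\infty$ is the same without Cut. -}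

module Defs where

open import Data.Nat using (ℕ; zero; suc; _≤_; _<_)
open import Data.Fin using (Fin; toℕ)
open import Data.List using (List; []; _∷_; _++_; [_]; map; take; tabulate; lookup)
open import Data.List.Relation.Binary.Permutation.Propositional using (_↭_)
open import Data.List.Relation.Binary.Pointwise using (Pointwise)
open import Data.List.Relation.Unary.All using (All)
open import Data.Vec using (Vec; toList)
import Data.Vec as Vec
open import Data.Product using (Σ; ∃; ∃-syntax; _×_; _,_; proj₁; proj₂)
open import Data.Maybe using (Maybe; just; nothing; _>>=_)
open import Relation.Binary.PropositionalEquality using (_≡_)

infixr 6 _⇒_
infixr 7 _▷_

data Fm : Set where
  var  : ℕ → Fm
  ⊥'   : Fm
  _⇒_  : Fm → Fm → Fm
  _▷_  : Fm → Fm → Fm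

-- Sequents Γ ⇒ Δ : pairs of finite multisets of formulas.
-- A multiset is represented by a list; two lists denote the same
-- multiset iff they are permutations of each other (_↭_).

Sequent : Set
Sequent = List Fm × List Fm

_≈S_ : Sequent → Sequent → Set
(Γ , Δ) ≈S (Γ' , Δ') = (Γ ↭ Γ') × (Δ ↭ Δ')

_▷⊥ : List Fm → List Fm
Σs ▷⊥ = map (λ σ → σ ▷ ⊥') Σs

data Tag : Set where
  ax ⊥L ⊥R →L →R ▷IL ▷IK4 cut : Tag

-- Premises of the ▷ rules.
-- φs = (φ_0,…,φ_{m-1}), ψs = (ψ_0,…,ψ_{m-1}), ψm = ψ_m, and φ is the
-- formula in ψ_m ▷ φ.  Premise i (i = 0,…,m), with Φ_{[0,i)} = take i φs:
--   IL  : ψ_i , (ψ_i , Φ_{[0,i)} , φ) ▷ ⊥ ⇒ Φ_{[0,i)} , φ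
--   IK4 : ψ_i , (Φ_{[0,i)} , φ) ▷ ⊥      ⇒ Φ_{[0,i)} , φ

Φ< : ∀ {m} → Vec Fm m → ℕ → List Fm
Φ< φs i = take i (toList φs)

ψAt : ∀ {m} → Vec Fm m → Fm → Fin (suc m) → Fm
ψAt ψs ψm i = Vec.lookup (ψs Vec.∷ʳ ψm) i

premIL : ∀ {m} → Vec Fm m → Vec Fm m → Fm → Fm → Fin (suc m) → Sequent
premIL φs ψs ψm φ i =
  (ψAt ψs ψm i ∷ ((ψAt ψs ψm i ∷ Φ< φs (toℕ i) ++ [ φ ]) ▷⊥))
  , (Φ< φs (toℕ i) ++ [ φ ])

premIK4 : ∀ {m} → Vec Fm m → Vec Fm m → Fm → Fm → Fin (suc m) → Sequent
premIK4 φs ψs ψm φ i =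
  (ψAt ψs ψm i ∷ ((Φ< φs (toℕ i) ++ [ φ ]) ▷⊥))
  , (Φ< φs (toℕ i) ++ [ φ ])

concl▷ : ∀ {m} → Vec Fm m → Vec Fm m → Fm → Fm → List Fm → List Fm → Sequent
concl▷ φs ψs ψm φ Γ Δ =
  (toList (Vec.zipWith _▷_ φs ψs) ++ Γ) , ((ψm ▷ φ) ∷ Δ)

data Rule : Tag → List Sequent → Sequent → Set where
  ax   : ∀ p Γ Δ → Rule ax [] (var p ∷ Γ , var p ∷ Δ)
  ⊥L   : ∀ Γ Δ → Rule ⊥L [] (⊥' ∷ Γ , Δ)
  ⊥R   : ∀ Γ Δ → Rule ⊥R [ (Γ , Δ) ] (Γ , ⊥' ∷ Δ)
  →L   : ∀ φ ψ Γ Δ →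
         Rule →L ((Γ , Δ ++ [ φ ]) ∷ (ψ ∷ Γ , Δ) ∷ []) ((φ ⇒ ψ) ∷ Γ , Δ)
  →R   : ∀ φ ψ Γ Δ →
         Rule →R [ (φ ∷ Γ , Δ ++ [ ψ ]) ] (Γ , Δ ++ [ φ ⇒ ψ ])
  ▷IL  : ∀ m (φs ψs : Vec Fm m) ψm φ Γ Δ →
         Rule ▷IL (tabulate (premIL φs ψs ψm φ)) (concl▷ φs ψs ψm φ Γ Δ)
  ▷IK4 : ∀ m (φs ψs : Vec Fm m) ψm φ Γ Δ →
         Rule ▷IK4 (tabulate (premIK4 φs ψs ψm φ)) (concl▷ φs ψs ψm φ Γ Δ)
  cut  : ∀ χ Γ Δ →
         Rule cut ((Γ , Δ ++ [ χ ]) ∷ (χ ∷ Γ , Δ) ∷ []) (Γ , Δ)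

Inst : Tag → List Sequent → Sequent → Set
Inst r ps c = ∃[ ps' ] ∃[ c' ] (Rule r ps' c' × Pointwise _≈S_ ps ps' × (c ≈S c'))

data FinCut : Tag → Set where
  ax : FinCut ax
  ⊥L : FinCut ⊥L
  ⊥R : FinCut ⊥R
  →L : FinCut →L
  →R : FinCut →R
  ▷IL : FinCut ▷IL
  cut : FinCut cut

data ⊢fin+Cut_ : Sequent → Set where
  node : ∀ {r ps s} → FinCut r → Inst r ps s → All ⊢fin+Cut_ ps → ⊢fin+Cut s

data InfCut : Tag → Set where
  ax : InfCut ax
  ⊥L : InfCut ⊥L
  ⊥R : InfCut ⊥R
  →L : InfCut →L
  →R : InfCut →R
  ▷IK4 : InfCut ▷IK4
  cut : InfCut cut

-- A (possibly infinite) finitely branching labelled tree, given by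
-- labellings of all addresses; the nodes of the tree are the addresses
-- reachable from the root (Pos below).  An address is the list of child
-- indices from the node back to the root (most recent step first).
record Tree : Set where
  field
    seq   : List ℕ → Sequent
    rule  : List ℕ → Tag
    arity : List ℕ → ℕ
open Tree public

data Pos (t : Tree) : List ℕ → Set where
  root : Pos t []
  step : ∀ {a j} → Pos t a → j < arity t a → Pos t (j ∷ a)

kidSeqs : Tree → List ℕ → List Sequent
kidSeqs t a = tabulate {n = arity t a} (λ j → seq t (toℕ j ∷ a))

LocallyCorrect : Tree → Set
LocallyCorrect t = ∀ a → Pos t a →
  InfCut (rule t a) × Inst (rule t a) (kidSeqs t a) (seq t a)

prefix : (ℕ → ℕ) → ℕ → List ℕ
prefix b zero    = []
prefix b (suc n) = b n ∷ prefix b n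

InfiniteBranch : Tree → (ℕ → ℕ) → Set
InfiniteBranch t b = ∀ n → Pos t (prefix b n)

-- the branch passes infinitely often from the conclusion of a ▷IK4
-- instance to one of its premises (the node at depth m is labelled ▷IK4
-- and, the branch being infinite, it continues to one of its children)
InfinitelyOftenIK4 : Tree → (ℕ → ℕ) → Set
InfinitelyOftenIK4 t b = ∀ n → ∃[ m ] (n ≤ m × rule t (prefix b m) ≡ ▷IK4)

Proof∞+Cut : Sequent → Tree → Set
Proof∞+Cut s t = seq t [] ≡ s × LocallyCorrect t
  × (∀ b → InfiniteBranch t b → InfinitelyOftenIK4 t b)

⊢∞+Cut_ : Sequent → Set
⊢∞+Cut s = ∃[ t ] Proof∞+Cut s t

{-# OPTIONS --safe #-}
module Submission where

-- ▷IL differs from ▷IK4 only by the extra hypothesis ψ ▷ ⊥ in its premises, so a ▷IL step becomes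
-- a ▷IK4 step once each ▷IK4 premise  ψ, Z ▷ ⊥ ⇒ Z  (Z = Φ_{[0,i)}, φ) is derived from the ▷IL
-- premise  ψ, ψ ▷ ⊥, Z ▷ ⊥ ⇒ Z.  Cut on ⊥ ▷ ⊥ (provable by ▷IK4 from the axiom ⊥, ⊥ ▷ ⊥ ⇒ ⊥) and
-- then on ψ ▷ ⊥; the right premise of the second cut is the ▷IL premise, weakened.  Its left
-- premise  ψ, Z ▷ ⊥, ⊥ ▷ ⊥ ⇒ Z, ψ ▷ ⊥  follows by ▷IK4 with side formulas Z ▷ ⊥ (all premises but
-- the last have ⊥ on the left), and by ⊥R the last premise  ψ, (Z, ⊥) ▷ ⊥ ⇒ Z, ⊥  reduces to the
-- sequent the second cut started from.  Every other step copies a rule of the finite proof, so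
-- along non-▷IK4 steps the height of the finite proof being copied, plus a bounded offset, decreases.

open import Defs
open import Data.Nat using (ℕ; zero; suc; _≤_; _<_; _⊔_; s≤s; z<s)
open import Data.Nat.Properties using (≤-refl; ≤-trans; <-≤-trans; <⇒≤; m≤m⊔n; m≤n⊔m; n<1+n)
open import Data.Fin using (Fin; toℕ; zero; suc)
open import Data.List using (List; []; _∷_; _++_; [_]; map; take; tabulate; length)
open import Data.List.Properties using (++-identityʳ; ++-assoc; map-++; map-tabulate; take-all)
open import Data.List.Relation.Binary.Permutation.Propositional
  using (_↭_; swap; ↭-refl; ↭-sym; ↭-trans; ↭-reflexive; ↭-isEquivalence)
open import Data.List.Relation.Binary.Permutation.Propositional.Properties using (++⁺ʳ; shift; ∷↭∷ʳ)
import Data.List.Relation.Binary.Pointwise as Pointwise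
open Pointwise using (Pointwise; []; _∷_)
open import Data.List.Relation.Unary.All using (All; []; _∷_; reduce)
import Data.List.Relation.Unary.All.Properties as All
open import Data.Vec using (Vec; toList; fromList)
import Data.Vec as Vec
open import Data.Vec.Properties using (toList∘fromList)
open import Data.Product using (∃-syntax; _×_; _,_; map₂)
open import Data.Product.Relation.Binary.Pointwise.NonDependent using (×-isEquivalence)
open import Data.Sum using (_⊎_; inj₁; inj₂)
open import Function using (_∘_)
open import Relation.Binary.Structures using (IsEquivalence)
open import Relation.Nullary using (contradiction)
open import Relation.Binary.PropositionalEquality using (_≡_; _≢_; refl; sym; trans; cong; subst)

open IsEquivalence (×-isEquivalence {R = _↭_ {A = Fm}} {S = _↭_ {A = Fm}} ↭-isEquivalence ↭-isEquivalence)
  using () renaming (refl to ≈S-refl; sym to ≈S-sym; trans to ≈S-trans; reflexive to ≈S-reflexive)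

lookupOr : {A : Set} → A → List A → ℕ → A
lookupOr d []       j       = d
lookupOr d (x ∷ xs) zero    = x
lookupOr d (x ∷ xs) (suc j) = lookupOr d xs j

tabulate-lookupOr : ∀ {A B : Set} (f : A → B) d (xs : List A) →
                    tabulate {n = length xs} (λ j → f (lookupOr d xs (toℕ j))) ≡ map f xs
tabulate-lookupOr f d []       = refl
tabulate-lookupOr f d (x ∷ xs) = cong (f x ∷_) (tabulate-lookupOr f d xs)

All-lookupOr : ∀ {A : Set} {P : A → Set} {d} {xs : List A} {j} →
               All P xs → j < length xs → P (lookupOr d xs j)
All-lookupOr {j = zero}  (px ∷ _)   _         = px
All-lookupOr {j = suc j} (_  ∷ pxs) (s≤s j<n) = All-lookupOr pxs j<n

lookup-replicate-∷ʳ : ∀ {A : Set} m (x y : A) (i : Fin (suc m)) →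
  (toℕ i ≡ m × Vec.lookup (Vec.replicate m x Vec.∷ʳ y) i ≡ y) ⊎ Vec.lookup (Vec.replicate m x Vec.∷ʳ y) i ≡ x
lookup-replicate-∷ʳ zero    x y zero    = inj₁ (refl , refl)
lookup-replicate-∷ʳ (suc m) x y zero    = inj₂ refl
lookup-replicate-∷ʳ (suc m) x y (suc i) with lookup-replicate-∷ʳ m x y i
... | inj₁ (i≡m , lookup≡y) = inj₁ (cong suc i≡m , lookup≡y)
... | inj₂ lookup≡x         = inj₂ lookup≡x

Φ<-fromList-length : ∀ Z → Φ< (fromList Z) (length Z) ≡ Z
Φ<-fromList-length Z = trans (cong (take (length Z)) (toList∘fromList Z)) (take-all (length Z) Z ≤-refl)

zipWith▷-replicate⊥ : ∀ Z → toList (Vec.zipWith _▷_ (fromList Z) (Vec.replicate (length Z) ⊥')) ≡ Z ▷⊥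
zipWith▷-replicate⊥ []      = refl
zipWith▷-replicate⊥ (φ ∷ Z) = cong (φ ▷ ⊥' ∷_) (zipWith▷-replicate⊥ Z)

CorrectNode : Tag → List Sequent → Sequent → Set
CorrectNode r ps s = InfCut r × Inst r ps s

Pos-child< : ∀ {t j a} → Pos t (j ∷ a) → j < arity t a
Pos-child< (step _ j<n) = j<n

module Unfolding
  {State : Set}
  (seqOf : State → Sequent)
  (ruleOf : State → Tag)
  (children : State → List State)
  (rank : State → ℕ)
  (locallyCorrect : ∀ q → CorrectNode (ruleOf q) (map seqOf (children q)) (seqOf q))
  (progressive : ∀ q → ruleOf q ≡ ▷IK4 ⊎ All (λ c → rank c < rank q) (children q))
  where

  -- Addresses outside the tree (excluded by Pos) are sent to the parent state.
  stateAt : State → List ℕ → State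
  stateAt q []      = q
  stateAt q (j ∷ a) = lookupOr (stateAt q a) (children (stateAt q a)) j

  unfold : State → Tree
  unfold q = record
    { seq   = seqOf ∘ stateAt q
    ; rule  = ruleOf ∘ stateAt q
    ; arity = length ∘ children ∘ stateAt q
    }

  unfold-locallyCorrect : ∀ q → LocallyCorrect (unfold q)
  unfold-locallyCorrect q a _ =
    map₂ (subst (λ ps → Inst (ruleOf p) ps (seqOf p)) (sym (tabulate-lookupOr seqOf p (children p))))
         (locallyCorrect p)
    where p = stateAt q a

  module _ (q : State) (b : ℕ → ℕ) (infinite : InfiniteBranch (unfold q) b) where

    reaches▷IK4 : ∀ k n → rank (stateAt q (prefix b n)) < k →
                  ∃[ m ] (n ≤ m × ruleOf (stateAt q (prefix b m)) ≡ ▷IK4)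
    reaches▷IK4 (suc k) n (s≤s rank≤k) with progressive (stateAt q (prefix b n))
    ... | inj₁ isIK4      = n , ≤-refl , isIK4
    ... | inj₂ decreasing
      with reaches▷IK4 k (suc n) (<-≤-trans (All-lookupOr decreasing (Pos-child< (infinite (suc n)))) rank≤k)
    ...   | m , n<m , isIK4 = m , <⇒≤ n<m , isIK4

    unfold-infinitelyOften : InfinitelyOftenIK4 (unfold q) b
    unfold-infinitelyOften n = reaches▷IK4 (suc (rank (stateAt q (prefix b n)))) n ≤-refl

  unfold-proves : ∀ q → Proof∞+Cut (seqOf q) (unfold q)
  unfold-proves q = refl , unfold-locallyCorrect q , unfold-infinitelyOften q

weakenˡ : List Fm → Sequent → Sequent
weakenˡ W (Γ , Δ) = Γ ++ W , Δ

weakenˡ-[] : ∀ s → weakenˡ [] s ≡ s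
weakenˡ-[] (Γ , Δ) = cong (_, Δ) (++-identityʳ Γ)

weakenˡ-resp-≈S : ∀ W {s s'} → s ≈S s' → weakenˡ W s ≈S weakenˡ W s'
weakenˡ-resp-≈S W (Γ↭Γ' , Δ↭Δ') = ++⁺ʳ W Γ↭Γ' , Δ↭Δ'

weaken-Rule : ∀ {r ps c} W → r ≢ ▷IL → r ≢ ▷IK4 →
              Rule r ps c → Rule r (map (weakenˡ W) ps) (weakenˡ W c)
weaken-Rule W _ _ (ax p Γ Δ)                  = ax p (Γ ++ W) Δ
weaken-Rule W _ _ (⊥L Γ Δ)                    = ⊥L (Γ ++ W) Δ
weaken-Rule W _ _ (⊥R Γ Δ)                    = ⊥R (Γ ++ W) Δ
weaken-Rule W _ _ (→L φ ψ Γ Δ)                = →L φ ψ (Γ ++ W) Δ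
weaken-Rule W _ _ (→R φ ψ Γ Δ)                = →R φ ψ (Γ ++ W) Δ
weaken-Rule W _ _ (cut χ Γ Δ)                 = cut χ (Γ ++ W) Δ
weaken-Rule W r≢IL _ (▷IL m φs ψs ψm φ Γ Δ)   = contradiction refl r≢IL
weaken-Rule W _ r≢IK4 (▷IK4 m φs ψs ψm φ Γ Δ) = contradiction refl r≢IK4

weaken-Inst : ∀ {r ps s} W → r ≢ ▷IL → r ≢ ▷IK4 →
              Inst r ps s → Inst r (map (weakenˡ W) ps) (weakenˡ W s)
weaken-Inst W r≢IL r≢IK4 (ps' , c' , rule , ps≈ , s≈) =
  map (weakenˡ W) ps' , weakenˡ W c' , weaken-Rule W r≢IL r≢IK4 rule ,
  Pointwise.map⁺ _ _ (Pointwise.map (weakenˡ-resp-≈S W) ps≈) , weakenˡ-resp-≈S W s≈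

⊢fin+Cut-resp-≈S : ∀ {s s'} → s ≈S s' → ⊢fin+Cut s → ⊢fin+Cut s'
⊢fin+Cut-resp-≈S s≈s' (node r (ps' , c' , rule , ps≈ , s≈c') πs) =
  node r (ps' , c' , rule , ps≈ , ≈S-trans (≈S-sym s≈s') s≈c') πs

premises : ∀ {n ps} {f : Fin n → Sequent} → Pointwise _≈S_ ps (tabulate f) →
           All ⊢fin+Cut_ ps → ∀ i → ⊢fin+Cut f i
premises ps≈ πs = All.tabulate⁻ (Pointwise.All-resp-Pointwise ⊢fin+Cut-resp-≈S ps≈ πs)

height : ∀ {s} → ⊢fin+Cut s → ℕ
maxHeight : ∀ {ps} → All ⊢fin+Cut_ ps → ℕ

height (node _ _ πs) = suc (maxHeight πs)

maxHeight []       = 0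
maxHeight (π ∷ πs) = height π ⊔ maxHeight πs

⊥▷⊥ : Fm
⊥▷⊥ = ⊥' ▷ ⊥'

-- embed π W copies π with W added to every antecedent; the other states derive a ▷IK4 premise
-- from the ▷IL premise they carry.
data State : Set where
  embed : ∀ {s} → ⊢fin+Cut s → List Fm → State
  ik4Premise loopHead box loopBack : (ψ : Fm) (Z : List Fm) → ⊢fin+Cut (ψ ∷ (ψ ∷ Z) ▷⊥ , Z) → State
  intro⊥▷⊥ axiom⊥ : List Fm → List Fm → State

seqOf : State → Sequent
seqOf (embed {s} _ W)    = weakenˡ W s
seqOf (ik4Premise ψ Z _) = ψ ∷ Z ▷⊥ , Z
seqOf (loopHead ψ Z _)   = ψ ∷ Z ▷⊥ ++ [ ⊥▷⊥ ] , Z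
seqOf (box ψ Z _)        = ψ ∷ Z ▷⊥ ++ [ ⊥▷⊥ ] , Z ++ [ ψ ▷ ⊥' ]
seqOf (loopBack ψ Z _)   = ψ ∷ (Z ++ [ ⊥' ]) ▷⊥ , Z ++ [ ⊥' ]
seqOf (intro⊥▷⊥ Γ Δ)     = Γ , Δ ++ [ ⊥▷⊥ ]
seqOf (axiom⊥ Γ Δ)       = ⊥' ∷ Γ , Δ

ruleOf : State → Tag
ruleOf (embed (node ▷IL _ _) _)   = ▷IK4
ruleOf (embed (node {r} _ _ _) _) = r
ruleOf (ik4Premise _ _ _)         = cut
ruleOf (loopHead _ _ _)           = cut
ruleOf (box _ _ _)                = ▷IK4
ruleOf (loopBack _ _ _)           = ⊥R
ruleOf (intro⊥▷⊥ _ _)             = ▷IK4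
ruleOf (axiom⊥ _ _)               = ⊥L

ik4PremiseAt : ∀ {m} (φs ψs : Vec Fm m) ψm φ → (∀ i → ⊢fin+Cut premIL φs ψs ψm φ i) → Fin (suc m) → State
ik4PremiseAt φs ψs ψm φ πs i = ik4Premise (ψAt ψs ψm i) (Φ< φs (toℕ i) ++ [ φ ]) (πs i)

boxRulePremise : (ψ : Fm) (Z : List Fm) → Fin (suc (length Z)) → Sequent
boxRulePremise ψ Z = premIK4 (fromList Z) (Vec.replicate (length Z) ⊥') ψ ⊥'

boxPremise : ∀ ψ Z → ⊢fin+Cut (ψ ∷ (ψ ∷ Z) ▷⊥ , Z) → Fin (suc (length Z)) → State
boxPremise ψ Z π i with lookup-replicate-∷ʳ (length Z) ⊥' ψ i
... | inj₁ _ = loopBack ψ Z π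
... | inj₂ _ = axiom⊥ ((Φ ++ [ ⊥' ]) ▷⊥) (Φ ++ [ ⊥' ])
  where Φ = Φ< (fromList Z) (toℕ i)

children : State → List State
children (embed (node ▷IL (_ , _ , ▷IL m φs ψs ψm φ Γ Δ , ps≈ , _) πs) _) =
  tabulate (ik4PremiseAt φs ψs ψm φ (premises ps≈ πs))
children (embed (node _ _ πs) W) = reduce (λ π → embed π W) πs
children (ik4Premise ψ Z π)      = intro⊥▷⊥ (ψ ∷ Z ▷⊥) Z ∷ loopHead ψ Z π ∷ []
children (loopHead ψ Z π)        = box ψ Z π ∷ embed π [ ⊥▷⊥ ] ∷ []
children (box ψ Z π)             = tabulate (boxPremise ψ Z π)
children (loopBack ψ Z π)        = loopHead ψ Z π ∷ []
children (intro⊥▷⊥ _ _)          = axiom⊥ [ ⊥▷⊥ ] [ ⊥' ] ∷ []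
children (axiom⊥ _ _)            = []

rank : State → ℕ
rank (embed π _)        = height π
rank (ik4Premise _ _ π) = suc (suc (height π))
rank (loopHead _ _ π)   = suc (height π)
rank (box _ _ _)        = 0
rank (loopBack _ _ π)   = suc (suc (height π))
rank (intro⊥▷⊥ _ _)     = 0
rank (axiom⊥ _ _)       = 0

seqOf-embedAll : ∀ {ps} (πs : All ⊢fin+Cut_ ps) W →
                 map seqOf (reduce (λ π → embed π W) πs) ≡ map (weakenˡ W) ps
seqOf-embedAll []       W = refl
seqOf-embedAll (π ∷ πs) W = cong (_ ∷_) (seqOf-embedAll πs W)

embed-Inst : ∀ {r ps s} → r ≢ ▷IL → r ≢ ▷IK4 → Inst r ps s → (πs : All ⊢fin+Cut_ ps) → ∀ W →
             Inst r (map seqOf (reduce (λ π → embed π W) πs)) (weakenˡ W s)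
embed-Inst {r} {s = s} r≢IL r≢IK4 inst πs W =
  subst (λ ps → Inst r ps (weakenˡ W s)) (sym (seqOf-embedAll πs W)) (weaken-Inst W r≢IL r≢IK4 inst)

embed-locallyCorrect : ∀ {s} (π : ⊢fin+Cut s) W →
  CorrectNode (ruleOf (embed π W)) (map seqOf (children (embed π W))) (weakenˡ W s)
embed-locallyCorrect (node ax  inst πs) W = ax  , embed-Inst (λ ()) (λ ()) inst πs W
embed-locallyCorrect (node ⊥L  inst πs) W = ⊥L  , embed-Inst (λ ()) (λ ()) inst πs W
embed-locallyCorrect (node ⊥R  inst πs) W = ⊥R  , embed-Inst (λ ()) (λ ()) inst πs W
embed-locallyCorrect (node →L  inst πs) W = →L  , embed-Inst (λ ()) (λ ()) inst πs W
embed-locallyCorrect (node →R  inst πs) W = →R  , embed-Inst (λ ()) (λ ()) inst πs W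
embed-locallyCorrect (node cut inst πs) W = cut , embed-Inst (λ ()) (λ ()) inst πs W
embed-locallyCorrect (node ▷IL (_ , _ , ▷IL m φs ψs ψm φ Γ Δ , ps≈ , s≈) πs) W =
  ▷IK4 , (_ , _ , ▷IK4 m φs ψs ψm φ (Γ ++ W) Δ ,
          Pointwise.map ≈S-reflexive (Pointwise.≡⇒Pointwise-≡ (map-tabulate ik4Premises seqOf)) ,
          ≈S-trans (weakenˡ-resp-≈S W s≈) (↭-reflexive (++-assoc _ Γ W) , ↭-refl))
  where ik4Premises = ik4PremiseAt φs ψs ψm φ (premises ps≈ πs)

boxPremise-≈S : ∀ ψ Z π i → seqOf (boxPremise ψ Z π i) ≈S boxRulePremise ψ Z i
boxPremise-≈S ψ Z π i with lookup-replicate-∷ʳ (length Z) ⊥' ψ i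
... | inj₁ (i≡last , lookup≡ψ) rewrite i≡last | Φ<-fromList-length Z | lookup≡ψ = ≈S-refl
... | inj₂ lookup≡⊥ = ↭-reflexive (cong (_∷ _) (sym lookup≡⊥)) , ↭-refl

box-locallyCorrect : ∀ ψ Z π → CorrectNode ▷IK4 (map seqOf (tabulate (boxPremise ψ Z π))) (seqOf (box ψ Z π))
box-locallyCorrect ψ Z π =
  ▷IK4 , (_ , _ , ▷IK4 (length Z) (fromList Z) (Vec.replicate (length Z) ⊥') ψ ⊥' (ψ ∷ [ ⊥▷⊥ ]) Z ,
          subst (λ ps → Pointwise _≈S_ ps (tabulate (boxRulePremise ψ Z)))
                (sym (map-tabulate (boxPremise ψ Z π) seqOf))
                (Pointwise.tabulate⁺ (boxPremise-≈S ψ Z π)) ,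
          (antecedent↭ , ↭-sym (∷↭∷ʳ (ψ ▷ ⊥') Z)))
  where
  antecedent↭ : ψ ∷ Z ▷⊥ ++ [ ⊥▷⊥ ] ↭ toList (Vec.zipWith _▷_ (fromList Z) (Vec.replicate (length Z) ⊥')) ++ ψ ∷ [ ⊥▷⊥ ]
  antecedent↭ = ↭-trans (↭-sym (shift ψ (Z ▷⊥) [ ⊥▷⊥ ]))
                        (↭-reflexive (cong (_++ ψ ∷ [ ⊥▷⊥ ]) (sym (zipWith▷-replicate⊥ Z))))

locallyCorrect : ∀ q → CorrectNode (ruleOf q) (map seqOf (children q)) (seqOf q)
locallyCorrect (embed π W)        = embed-locallyCorrect π W
locallyCorrect (ik4Premise ψ Z π) =
  cut , (_ , _ , cut ⊥▷⊥ (ψ ∷ Z ▷⊥) Z ,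
         ≈S-refl ∷ (↭-sym (∷↭∷ʳ ⊥▷⊥ (ψ ∷ Z ▷⊥)) , ↭-refl) ∷ [] , ≈S-refl)
locallyCorrect (loopHead ψ Z π)   =
  cut , (_ , _ , cut (ψ ▷ ⊥') (ψ ∷ Z ▷⊥ ++ [ ⊥▷⊥ ]) Z ,
         ≈S-refl ∷ (swap ψ (ψ ▷ ⊥') ↭-refl , ↭-refl) ∷ [] , ≈S-refl)
locallyCorrect (box ψ Z π)        = box-locallyCorrect ψ Z π
locallyCorrect (loopBack ψ Z π)   =
  ⊥R , (_ , _ , ⊥R (ψ ∷ (Z ++ [ ⊥' ]) ▷⊥) Z ,
        (↭-reflexive (cong (ψ ∷_) (sym (map-++ _ Z [ ⊥' ]))) , ↭-refl) ∷ [] ,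
        (↭-refl , ↭-sym (∷↭∷ʳ ⊥' Z)))
locallyCorrect (intro⊥▷⊥ Γ Δ)     =
  ▷IK4 , (_ , _ , ▷IK4 0 Vec.[] Vec.[] ⊥' ⊥' Γ Δ , ≈S-refl ∷ [] , (↭-refl , ↭-sym (∷↭∷ʳ ⊥▷⊥ Δ)))
locallyCorrect (axiom⊥ Γ Δ)       = ⊥L , (_ , _ , ⊥L Γ Δ , [] , ≈S-refl)

embedAll-rank< : ∀ {ps} (πs : All ⊢fin+Cut_ ps) W {k} → maxHeight πs ≤ k →
                 All (λ c → rank c < suc k) (reduce (λ π → embed π W) πs)
embedAll-rank< []       W _  = []
embedAll-rank< (π ∷ πs) W ≤k =
  s≤s (≤-trans (m≤m⊔n _ _) ≤k) ∷ embedAll-rank< πs W (≤-trans (m≤n⊔m (height π) _) ≤k)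

progressive : ∀ q → ruleOf q ≡ ▷IK4 ⊎ All (λ c → rank c < rank q) (children q)
progressive (embed (node ax  _ πs) W) = inj₂ (embedAll-rank< πs W ≤-refl)
progressive (embed (node ⊥L  _ πs) W) = inj₂ (embedAll-rank< πs W ≤-refl)
progressive (embed (node ⊥R  _ πs) W) = inj₂ (embedAll-rank< πs W ≤-refl)
progressive (embed (node →L  _ πs) W) = inj₂ (embedAll-rank< πs W ≤-refl)
progressive (embed (node →R  _ πs) W) = inj₂ (embedAll-rank< πs W ≤-refl)
progressive (embed (node cut _ πs) W) = inj₂ (embedAll-rank< πs W ≤-refl)
progressive (embed (node ▷IL _ _) _)  = inj₁ refl
progressive (ik4Premise _ _ _)        = inj₂ (z<s ∷ n<1+n _ ∷ [])
progressive (loopHead _ _ _)          = inj₂ (z<s ∷ n<1+n _ ∷ [])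
progressive (box _ _ _)               = inj₁ refl
progressive (loopBack _ _ _)          = inj₂ (n<1+n _ ∷ [])
progressive (intro⊥▷⊥ _ _)            = inj₁ refl
progressive (axiom⊥ _ _)              = inj₂ []

open Unfolding seqOf ruleOf children rank locallyCorrect progressive

mainTheorem4 : ∀ (S : Sequent) → ⊢fin+Cut S → ⊢∞+Cut S
mainTheorem4 S π = subst ⊢∞+Cut_ (weakenˡ-[] S) (unfold q , unfold-proves q)
  where q = embed π []
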